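{- For all integers $a,b,c_1,c_2$, \[ U(a,b,c_1)+U(a,c_1+c_2-b,c_2)\in\mathrm{Ker}(L)\quad\text{and}\quad U(a,b,b)\in\mathrm{Ker}(L). \]
   Context: $\tau(i)=|i+1|-1$. $\tilde{\mathrm{CH}}_2$: the ring generated by $\tilde h_i$, $i\in\mathbb{Z}$; its elements are finite integer linear combinations of the linearly independent symbols $\tilde h_i$ (multiplication: $\tilde h_{ -1}\tilde h_j=0$, $\tilde h_i\tilde h_j=\sum_{k=0}^i\tilde h_{j-i+2k}$ for $i\ge0$, $\tilde h_i\tilde h_j=-\tilde h_{\tau(i)}\tilde h_j$ for $i<-1$). $\mathrm{CH}_2$: finite integer linear combinations of linearly independent symbols $h_i$, $i\ge0$. $L:\tilde{\mathrm{CH}}_2\to\mathrm{CH}_2$ is the linear map (ring homomorphism) $L(\tilde h_i)=\mathrm{sgn}(i+1)h_{\tau(i)}$, so $L(\tilde h_{ -1})=0$; $\mathrm{Ker}(L)$ is its kernel. For integers $a,b,c$: $U(a,b,c)=\mathrm{sgn}(a)\sum_{j=0}^{|a|-1}\tilde h_{c-b-|a|+2j}$, with $U(0,b,c)=0$. -}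

module Defs where

open import Data.Nat as ℕ using (ℕ; zero; suc)
open import Data.Integer as ℤ using (ℤ; +_; -[1+_]; _+_; _*_; -_; ∣_∣; 0ℤ; 1ℤ; -1ℤ)
open import Data.Product using (_×_; _,_)
open import Data.List using (List; []; _∷_; _++_; map)
open import Relation.Binary.PropositionalEquality using (_≡_)
open import Relation.Nullary using (yes; no)

sgn : ℤ → ℤ
sgn (+ zero)  = 0ℤ
sgn (+ suc _) = 1ℤ
sgn -[1+ _ ]  = -1ℤ

-- An element of the free abelian group CH~2 on symbols h~_i (i ∈ ℤ),
-- presented as a formal finite sum  Σ coeff · h~_index  (list of (coeff , index)).
CH~2 : Set
CH~2 = List (ℤ × ℤ)

CH2 : Set
CH2 = List (ℤ × ℕ)

-- coefficient of h_n in an element of CH2 (the symbols h_i are linearly independent)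
coeff : ℕ → CH2 → ℤ
coeff n [] = 0ℤ
coeff n ((k , i) ∷ xs) with i ℕ.≟ n
... | yes _ = k + coeff n xs
... | no _  = coeff n xs

-- τ(i) = |i+1| - 1 ; only used where i ≠ -1 matters (for i = -1 the coefficient is 0)
τ : ℤ → ℕ
τ i = ∣ i + 1ℤ ∣ ℕ.∸ 1

L : CH~2 → CH2
L = map (λ { (k , i) → (k * sgn (i + 1ℤ) , τ i) })

InKerL : CH~2 → Set
InKerL x = ∀ n → coeff n (L x) ≡ 0ℤ

U : ℤ → ℤ → ℤ → CH~2
U a b c = go ∣ a ∣
  where
  go : ℕ → CH~2
  go zero    = []
  go (suc j) = (sgn a , c ℤ.- b ℤ.- (+ ∣ a ∣) + (+ 2) * (+ j)) ∷ go j

_⊕_ : CH~2 → CH~2 → CH~2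
_⊕_ = _++_

{-# OPTIONS --safe #-}
-- The involution i ↦ -i-2 of the indices satisfies L(h̃_{-i-2}) = -L(h̃_i). The indices of
-- U(a,b,c) form the progression c-b-|a|, c-b-|a|+2, …, and when c′-b′ = b-c the indices of
-- U(a,b′,c′) are exactly the images of those of U(a,b,c) under this involution, so
-- L(U(a,b′,c′)) = -L(U(a,b,c)). Both claims are instances: (b,c₁) and (c₁+c₂-b,c₂) are such
-- a pair, and so is (b,b) with itself, whence L(U(a,b,b)) = -L(U(a,b,b)) = 0.
module Submission where

open import Defs
open import Data.Nat as ℕ using (ℕ; zero; suc)
open import Data.Integer using (ℤ; +_; +[1+_]; -[1+_]; _+_; _-_; -_; _*_; ∣_∣; 0ℤ; 1ℤ)
open import Data.Integer.Properties
  using (+-identityˡ; +-identityʳ; +-assoc; +-comm; +-inverseʳ; neg-distrib-+; neg-distribʳ-*; ∣-i∣≡∣i∣)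
open import Data.Integer.Tactic.RingSolver using (solve-∀)
open import Data.Product using (_×_; _,_)
open import Data.List using ([]; _∷_; _++_)
open import Data.List.Properties using (map-++)
open import Function using (_∘_)
open import Relation.Binary.PropositionalEquality
open import Relation.Nullary using (yes; no)

open ≡-Reasoning

coeff-++ : ∀ n xs ys → coeff n (xs ++ ys) ≡ coeff n xs + coeff n ys
coeff-++ n []             ys = sym (+-identityˡ _)
coeff-++ n ((k , i) ∷ xs) ys with i ℕ.≟ n
... | yes _ = trans (cong (_+_ k) (coeff-++ n xs ys)) (sym (+-assoc k _ _))
... | no _  = coeff-++ n xs ys

coeff-L-⊕ : ∀ n xs ys → coeff n (L (xs ⊕ ys)) ≡ coeff n (L xs) + coeff n (L ys)
coeff-L-⊕ n xs ys = trans (cong (coeff n) (map-++ _ xs ys)) (coeff-++ n (L xs) (L ys))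

coeff-neg-singleton : ∀ n k t → coeff n ((- k , t) ∷ []) ≡ - coeff n ((k , t) ∷ [])
coeff-neg-singleton n k t with t ℕ.≟ n
... | yes _ = trans (+-identityʳ (- k)) (cong -_ (sym (+-identityʳ k)))
... | no _  = refl

sgn-neg : ∀ i → sgn (- i) ≡ - sgn i
sgn-neg (+ zero)  = refl
sgn-neg +[1+ _ ]  = refl
sgn-neg -[1+ _ ]  = refl

reflect-suc : ∀ i → (- i - + 2) + 1ℤ ≡ - (i + 1ℤ)
reflect-suc = solve-∀

τ-reflect : ∀ i → τ (- i - + 2) ≡ τ i
τ-reflect i = cong (ℕ._∸ 1) (trans (cong ∣_∣ (reflect-suc i)) (∣-i∣≡∣i∣ (i + 1ℤ)))

coeff-L-reflect : ∀ n s i → coeff n (L ((s , - i - + 2) ∷ [])) ≡ - coeff n (L ((s , i) ∷ []))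
coeff-L-reflect n s i = begin
  coeff n ((s * sgn (- i - + 2 + 1ℤ) , τ (- i - + 2)) ∷ [])
    ≡⟨ cong₂ (λ σ t → coeff n ((s * σ , t) ∷ [])) (trans (cong sgn (reflect-suc i)) (sgn-neg (i + 1ℤ))) (τ-reflect i) ⟩
  coeff n ((s * - sgn (i + 1ℤ) , τ i) ∷ [])
    ≡⟨ cong (λ k → coeff n ((k , τ i) ∷ [])) (sym (neg-distribʳ-* s (sgn (i + 1ℤ)))) ⟩
  coeff n ((- (s * sgn (i + 1ℤ)) , τ i) ∷ [])
    ≡⟨ coeff-neg-singleton n (s * sgn (i + 1ℤ)) (τ i) ⟩
  - coeff n ((s * sgn (i + 1ℤ) , τ i) ∷ []) ∎

progression : ℤ → ℤ → ℕ → CH~2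
progression s x zero    = []
progression s x (suc j) = (s , x + + 2 * + j) ∷ progression s x j

progression-unique : ∀ {s x} (g : ℕ → CH~2) → g zero ≡ [] →
                     (∀ j → g (suc j) ≡ (s , x + + 2 * + j) ∷ g j) →
                     ∀ k → g k ≡ progression s x k
progression-unique g g0 gsuc zero    = g0
progression-unique g g0 gsuc (suc k) = trans (gsuc k) (cong (_ ∷_) (progression-unique g g0 gsuc k))

U≡progression : ∀ a b c → U a b c ≡ progression (sgn a) (c - b - + ∣ a ∣) ∣ a ∣
U≡progression a b c = unfold
  where
  -- The recursion local to U cannot be named; this meta is solved to it by unification
  -- once ∣ a ∣ has been abstracted to a variable.
  go : ℕ → CH~2
  go = _
  unfold : U a b c ≡ progression (sgn a) (c - b - + ∣ a ∣) ∣ a ∣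
  unfold with ∣ a ∣ in ∣a∣≡k
  ... | k = trans (progression-unique go refl (λ _ → refl) k)
                  (cong (λ m → progression (sgn a) (c - b - + m) k) ∣a∣≡k)

progression-snoc : ∀ s x k → progression s x (suc k) ≡ progression s (x + + 2) k ++ (s , x) ∷ []
progression-snoc s x zero    = cong (λ y → (s , y) ∷ []) (+-identityʳ x)
progression-snoc s x (suc k) = cong₂ (λ y v → (s , y) ∷ v) (shift x (+ k)) (progression-snoc s x k)
  where
  shift : ∀ x k → x + + 2 * (1ℤ + k) ≡ x + + 2 + + 2 * k
  shift = solve-∀

coeff-L-progression-reflect : ∀ n s x k →
  coeff n (L (progression s (- x - + 2 * + k) k)) ≡ - coeff n (L (progression s x k))
coeff-L-progression-reflect n s x zero    = refl
coeff-L-progression-reflect n s x (suc k) = begin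
  P y (suc k)                              ≡⟨ cong (coeff n ∘ L) (progression-snoc s y k) ⟩
  coeff n (L (progression s (y + + 2) k ⊕ ((s , y) ∷ [])))
                                           ≡⟨ coeff-L-⊕ n (progression s (y + + 2) k) _ ⟩
  P (y + + 2) k + t y                      ≡⟨ cong₂ (λ z w → P z k + t w) (inner x (+ k)) (outer x (+ k)) ⟩
  P (- x - + 2 * + k) k + t (- last - + 2) ≡⟨ cong₂ _+_ (coeff-L-progression-reflect n s x k) (coeff-L-reflect n s last) ⟩
  - P x k + - t last                       ≡⟨ sym (neg-distrib-+ (P x k) (t last)) ⟩
  - (P x k + t last)                       ≡⟨ cong -_ (+-comm (P x k) (t last)) ⟩
  - (t last + P x k)                       ≡⟨ cong -_ (sym (coeff-L-⊕ n ((s , last) ∷ []) (progression s x k))) ⟩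
  - P x (suc k)                            ∎
  where
  P : ℤ → ℕ → ℤ
  P z m = coeff n (L (progression s z m))
  t : ℤ → ℤ
  t i = coeff n (L ((s , i) ∷ []))
  y last : ℤ
  y    = - x - + 2 * + suc k
  last = x + + 2 * + k
  inner : ∀ x k → - x - + 2 * (1ℤ + k) + + 2 ≡ - x - + 2 * k
  inner = solve-∀
  outer : ∀ x k → - x - + 2 * (1ℤ + k) ≡ - (x + + 2 * k) - + 2
  outer = solve-∀

coeff-L-U-reflect : ∀ n a {b c b′ c′} → c′ - b′ ≡ b - c →
                    coeff n (L (U a b′ c′)) ≡ - coeff n (L (U a b c))
coeff-L-U-reflect n a {b} {c} {b′} {c′} c′-b′≡b-c = begin
  coeff n (L (U a b′ c′))
    ≡⟨ cong (coeff n ∘ L) (U≡progression a b′ c′) ⟩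
  coeff n (L (progression s (c′ - b′ - + k) k))
    ≡⟨ cong (λ z → coeff n (L (progression s z k))) base-reflect ⟩
  coeff n (L (progression s (- (c - b - + k) - + 2 * + k) k))
    ≡⟨ coeff-L-progression-reflect n s (c - b - + k) k ⟩
  - coeff n (L (progression s (c - b - + k) k))
    ≡⟨ cong (λ v → - coeff n (L v)) (sym (U≡progression a b c)) ⟩
  - coeff n (L (U a b c)) ∎
  where
  s : ℤ
  s = sgn a
  k : ℕ
  k = ∣ a ∣
  swap-base : ∀ b c k → b - c - k ≡ - (c - b - k) - + 2 * k
  swap-base = solve-∀
  base-reflect : c′ - b′ - + k ≡ - (c - b - + k) - + 2 * + k
  base-reflect = trans (cong (_- + k) c′-b′≡b-c) (swap-base b c (+ k))

i≡-i⇒i≡0 : ∀ i → i ≡ - i → i ≡ 0ℤ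
i≡-i⇒i≡0 (+ zero) _  = refl
i≡-i⇒i≡0 +[1+ _ ] ()
i≡-i⇒i≡0 -[1+ _ ] ()

lemma3p12 : (a b c₁ c₂ : ℤ) →
    InKerL (U a b c₁ ⊕ U a (c₁ + c₂ - b) c₂) × InKerL (U a b b)
lemma3p12 a b c₁ c₂ = cancels , self-cancels
  where
  pair : ∀ b c₁ c₂ → c₂ - (c₁ + c₂ - b) ≡ b - c₁
  pair = solve-∀
  cancels : InKerL (U a b c₁ ⊕ U a (c₁ + c₂ - b) c₂)
  cancels n = begin
    coeff n (L (U a b c₁ ⊕ U a (c₁ + c₂ - b) c₂))
      ≡⟨ coeff-L-⊕ n (U a b c₁) (U a (c₁ + c₂ - b) c₂) ⟩
    coeff n (L (U a b c₁)) + coeff n (L (U a (c₁ + c₂ - b) c₂))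
      ≡⟨ cong (_+_ (coeff n (L (U a b c₁)))) (coeff-L-U-reflect n a (pair b c₁ c₂)) ⟩
    coeff n (L (U a b c₁)) + - coeff n (L (U a b c₁))
      ≡⟨ +-inverseʳ (coeff n (L (U a b c₁))) ⟩
    0ℤ ∎
  self-cancels : InKerL (U a b b)
  self-cancels n = i≡-i⇒i≡0 _ (coeff-L-U-reflect n a refl)
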